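{- Every finite simple graph $G$ with vertex-edge diameter $d_{ve}(G)=2$ has optimal pegging number $p(G)\le 4$.
   Context: A graph is non-null if it has at least one edge. The distance between a vertex $x$ and an edge $e$ is the minimum distance from $x$ to an endpoint of $e$; the vertex-edge diameter $d_{ve}(G)$ of a non-null graph $G$ is the maximum distance between a vertex and an edge of $G$. A distribution of pegs on $G$ is a subset $D \subseteq V(G)$. If $u,v \in D$ are distinct adjacent vertices and $w \notin D$ is a vertex adjacent to $v$, the pegging move (jumping $u$ over $v$ into $w$) replaces $D$ by $(D\setminus\{u,v\})\cup\{w\}$. A vertex $t$ is reachable from $D$ if some finite (possibly empty) sequence of pegging moves starting from $D$ ends in a distribution containing $t$. The optimal pegging number $p(G)$ is the smallest positive integer $d$ such that some distribution of size $d$ on $G$ has every vertex reachable. -}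

module Defs where

open import Data.Nat using (ℕ; zero; suc; _≤_; _<_)
open import Data.Bool using (Bool; true; false)
open import Data.Fin using (Fin)
open import Data.Fin.Subset using (Subset; _∈_; _∉_; ∣_∣; ⁅_⁆; _∪_; _─_)
open import Data.Product using (Σ; ∃; ∃-syntax; _×_; _,_)
open import Data.Sum using (_⊎_)
open import Relation.Binary.PropositionalEquality using (_≡_; _≢_)
open import Relation.Nullary using (¬_)

record Graph (n : ℕ) : Set where
  field
    adj     : Fin n → Fin n → Bool
    sym     : ∀ u v → adj u v ≡ adj v u
    irrefl  : ∀ v → adj v v ≡ false
open Graph public

module _ {n : ℕ} (G : Graph n) where

  Adj : Fin n → Fin n → Set
  Adj u v = adj G u v ≡ true

  data Walk : Fin n → Fin n → ℕ → Set where
    here  : ∀ {u} → Walk u u zero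
    step  : ∀ {u v w k} → Adj u v → Walk v w k → Walk u w (suc k)

  DistLe : Fin n → Fin n → ℕ → Set
  DistLe u v k = ∃[ j ] (j ≤ k × Walk u v j)

  -- An edge is an (ordered representative of an) adjacent pair.
  -- dist(x, uv) ≤ k : distance from x to some endpoint is ≤ k.
  VEDistLe : Fin n → Fin n → Fin n → ℕ → Set
  VEDistLe x u v k = DistLe x u k ⊎ DistLe x v k

  NonNull : Set
  NonNull = ∃[ u ] ∃[ v ] Adj u v

  VEDiameterTwo : Set
  VEDiameterTwo =
    NonNull ×
    (∀ x u v → Adj u v → VEDistLe x u v 2) ×
    (∃[ x ] ∃[ u ] ∃[ v ] (Adj u v × ¬ VEDistLe x u v 1))

  data Move : Subset n → Subset n → Set where
    jump : ∀ {D u v w} → u ∈ D → v ∈ D → u ≢ v → Adj u v →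
           w ∉ D → Adj v w →
           Move D (((D ─ ⁅ u ⁆) ─ ⁅ v ⁆) ∪ ⁅ w ⁆)

  data Moves : Subset n → Subset n → Set where
    done : ∀ {D} → Moves D D
    more : ∀ {D E F} → Move D E → Moves E F → Moves D F

  Reachable : Subset n → Fin n → Set
  Reachable D t = ∃[ E ] (Moves D E × t ∈ E)

  Solvable : ℕ → Set
  Solvable d = ∃[ D ] (∣ D ∣ ≡ d × (∀ t → Reachable D t))

  -- p(G) ≤ k  iff  some positive d ≤ k admits such a distribution
  -- (p(G) is the least positive such d).
  PeggingNumberLe : ℕ → Set
  PeggingNumberLe k = ∃[ d ] (1 ≤ d × d ≤ k × Solvable d)

-- A vertex x at distance 2 from an edge uv lies on a path x y u v of four
-- distinct vertices r q a b; put a peg on each.  As d_ve(G) = 2, every vertex t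
-- is within distance 2 of the edge qa, say of a (for q, reverse the path).
-- If t is a neighbour of a, b jumps over a into t.  If t - c - a and c carries
-- a peg, a jumps over c into t.  Otherwise b jumps over a into c, r jumps over
-- q into the vacated a, and a jumps over c into t.
module Submission where

open import Data.Nat using (ℕ; suc; _≤_; _+_; z≤n; s≤s)
open import Data.Nat.Properties using (≤-trans; ≤-reflexive; +-suc; m≤n⇒m≤1+n)
open import Data.Fin using (Fin)
open import Data.Fin.Subset using (Subset; _∈_; _∉_; ∣_∣; ⁅_⁆; _∪_; _─_; inside; outside)
open import Data.Fin.Subset.Properties
  using (_∈?_; x∈⁅x⁆; x∈⁅y⁆⇒x≡y; x≢y⇒x∉⁅y⁆; ∣⁅x⁆∣≡1; x∈p∪q⁻; p⊆p∪q; q⊆p∪q; x∈p∧x∉q⇒x∈p─q; p─q⊆p; ∣p∣≤∣p∪q∣)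
open import Data.Vec using (_∷_; []; here; there)
open import Data.Product using (∃-syntax; _,_; proj₂)
open import Data.Sum using (inj₁; inj₂; swap)
open import Data.Empty using (⊥-elim)
open import Function using (_∘_)
open import Relation.Binary.PropositionalEquality using (_≢_; refl; sym; trans; subst)
open import Relation.Nullary using (¬_; yes; no)
open import Defs hiding (sym)
open Graph using () renaming (sym to adj-sym)

x∈q⇒x∉p─q : ∀ {n} {x : Fin n} (p q : Subset n) → x ∈ q → x ∉ p ─ q
x∈q⇒x∉p─q (_ ∷ p) (inside  ∷ q) here        ()
x∈q⇒x∉p─q (_ ∷ p) (outside ∷ q) (there x∈q) (there x∈p─q) = x∈q⇒x∉p─q p q x∈q x∈p─q
x∈q⇒x∉p─q (_ ∷ p) (inside  ∷ q) (there x∈q) (there x∈p─q) = x∈q⇒x∉p─q p q x∈q x∈p─q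

∣p∪q∣≤∣p∣+∣q∣ : ∀ {n} (p q : Subset n) → ∣ p ∪ q ∣ ≤ ∣ p ∣ + ∣ q ∣
∣p∪q∣≤∣p∣+∣q∣ []            []            = z≤n
∣p∪q∣≤∣p∣+∣q∣ (outside ∷ p) (outside ∷ q) = ∣p∪q∣≤∣p∣+∣q∣ p q
∣p∪q∣≤∣p∣+∣q∣ (outside ∷ p) (inside  ∷ q) =
  subst (suc ∣ p ∪ q ∣ ≤_) (sym (+-suc ∣ p ∣ ∣ q ∣)) (s≤s (∣p∪q∣≤∣p∣+∣q∣ p q))
∣p∪q∣≤∣p∣+∣q∣ (inside  ∷ p) (outside ∷ q) = s≤s (∣p∪q∣≤∣p∣+∣q∣ p q)
∣p∪q∣≤∣p∣+∣q∣ (inside  ∷ p) (inside  ∷ q) =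
  s≤s (subst (∣ p ∪ q ∣ ≤_) (sym (+-suc ∣ p ∣ ∣ q ∣)) (m≤n⇒m≤1+n (∣p∪q∣≤∣p∣+∣q∣ p q)))

∣⁅x⁆∪p∣≤1+∣p∣ : ∀ {n} (x : Fin n) (p : Subset n) → ∣ ⁅ x ⁆ ∪ p ∣ ≤ suc ∣ p ∣
∣⁅x⁆∪p∣≤1+∣p∣ x p = subst (λ k → ∣ ⁅ x ⁆ ∪ p ∣ ≤ k + ∣ p ∣) (∣⁅x⁆∣≡1 x) (∣p∪q∣≤∣p∣+∣q∣ ⁅ x ⁆ p)

fourSet : ∀ {n} → Fin n → Fin n → Fin n → Fin n → Subset n
fourSet w x y z = ⁅ w ⁆ ∪ ⁅ x ⁆ ∪ ⁅ y ⁆ ∪ ⁅ z ⁆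

∣fourSet∣≤4 : ∀ {n} (w x y z : Fin n) → ∣ fourSet w x y z ∣ ≤ 4
∣fourSet∣≤4 w x y z =
  ≤-trans (∣⁅x⁆∪p∣≤1+∣p∣ w _) (s≤s
  (≤-trans (∣⁅x⁆∪p∣≤1+∣p∣ x _) (s≤s
  (≤-trans (∣⁅x⁆∪p∣≤1+∣p∣ y _) (s≤s
  (≤-reflexive (∣⁅x⁆∣≡1 z)))))))

1≤∣fourSet∣ : ∀ {n} (w x y z : Fin n) → 1 ≤ ∣ fourSet w x y z ∣
1≤∣fourSet∣ w x y z = subst (_≤ ∣ fourSet w x y z ∣) (∣⁅x⁆∣≡1 w) (∣p∣≤∣p∪q∣ ⁅ w ⁆ _)

module _ {n : ℕ} (G : Graph n) where

  Adj-sym : ∀ {u v} → Adj G u v → Adj G v u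
  Adj-sym {u} {v} u~v = trans (adj-sym G v u) u~v

  Adj⇒≢ : ∀ {u v} → Adj G u v → u ≢ v
  Adj⇒≢ {u} u~u refl with trans (sym u~u) (irrefl G u)
  ... | ()

  afterJump : Subset n → Fin n → Fin n → Fin n → Subset n
  afterJump D u v w = ((D ─ ⁅ u ⁆) ─ ⁅ v ⁆) ∪ ⁅ w ⁆

  target∈afterJump : ∀ {D u v w} → w ∈ afterJump D u v w
  target∈afterJump {w = w} = q⊆p∪q _ _ (x∈⁅x⁆ w)

  ∈-afterJump : ∀ {D u v w x} → x ∈ D → x ≢ u → x ≢ v → x ∈ afterJump D u v w
  ∈-afterJump x∈D x≢u x≢v =
    p⊆p∪q _ (x∈p∧x∉q⇒x∈p─q (x∈p∧x∉q⇒x∈p─q x∈D (x≢y⇒x∉⁅y⁆ x≢u)) (x≢y⇒x∉⁅y⁆ x≢v))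

  ∉-afterJump : ∀ {D u v w x} → x ∉ D → x ≢ w → x ∉ afterJump D u v w
  ∉-afterJump {D} {u} {v} {w} x∉D x≢w x∈E with x∈p∪q⁻ _ ⁅ w ⁆ x∈E
  ... | inj₁ x∈D─u─v = x∉D (p─q⊆p D ⁅ u ⁆ (p─q⊆p (D ─ ⁅ u ⁆) ⁅ v ⁆ x∈D─u─v))
  ... | inj₂ x∈⁅w⁆   = x≢w (x∈⁅y⁆⇒x≡y w x∈⁅w⁆)

  jumped∉afterJump : ∀ {D u v w} → v ≢ w → v ∉ afterJump D u v w
  jumped∉afterJump {D} {u} {v} {w} v≢w v∈E with x∈p∪q⁻ _ ⁅ w ⁆ v∈E
  ... | inj₁ v∈D─u─v = x∈q⇒x∉p─q (D ─ ⁅ u ⁆) ⁅ v ⁆ (x∈⁅x⁆ v) v∈D─u─v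
  ... | inj₂ v∈⁅w⁆   = v≢w (x∈⁅y⁆⇒x≡y w v∈⁅w⁆)

  Move⇒Reachable : ∀ {D E t} → Move G D E → t ∈ E → Reachable G D t
  Move⇒Reachable {E = E} m t∈E = E , more m done , t∈E

  record Path₄ (r q a b : Fin n) : Set where
    field
      r~q : Adj G r q
      q~a : Adj G q a
      a~b : Adj G a b
      r≢a : r ≢ a
      r≢b : r ≢ b
      q≢b : q ≢ b

  Path₄-reverse : ∀ {r q a b} → Path₄ r q a b → Path₄ b a q r
  Path₄-reverse P = record
    { r~q = Adj-sym a~b ; q~a = Adj-sym q~a ; a~b = Adj-sym r~q
    ; r≢a = q≢b ∘ sym ; r≢b = r≢b ∘ sym ; q≢b = r≢a ∘ sym }
    where open Path₄ P

  far-from-edge⇒Path₄ : ∀ {x u v} → Adj G u v → ¬ VEDistLe G x u v 1 →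
                        DistLe G x u 2 → ∃[ y ] Path₄ x y u v
  far-from-edge⇒Path₄ u~v far (_ , _ , here) = ⊥-elim (far (inj₁ (0 , z≤n , here)))
  far-from-edge⇒Path₄ u~v far (_ , _ , step x~u here) =
    ⊥-elim (far (inj₁ (1 , s≤s z≤n , step x~u here)))
  far-from-edge⇒Path₄ u~v far (_ , _ , step {v = y} x~y (step y~u here)) = y , record
    { r~q = x~y ; q~a = y~u ; a~b = u~v
    ; r≢a = λ { refl → far (inj₁ (0 , z≤n , here)) }
    ; r≢b = λ { refl → far (inj₂ (0 , z≤n , here)) }
    ; q≢b = λ { refl → far (inj₂ (1 , s≤s z≤n , step x~y here)) } }
  far-from-edge⇒Path₄ u~v far (_ , s≤s (s≤s ()) , step _ (step _ (step _ _)))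

  module _ {D : Subset n} {r q a b : Fin n} (P : Path₄ r q a b)
           (r∈D : r ∈ D) (q∈D : q ∈ D) (a∈D : a ∈ D) (b∈D : b ∈ D) where
    open Path₄ P

    reachable-through-empty : ∀ {c t} → Adj G a c → Adj G c t → c ∉ D → t ∉ D →
                              Reachable G D t
    reachable-through-empty {c} {t} a~c c~t c∉D t∉D =
      afterJump E₂ a c t , more m₁ (more m₂ (more m₃ done)) , target∈afterJump
      where
        E₁ = afterJump D b a c
        E₂ = afterJump E₁ r q a
        m₁ : Move G D E₁
        m₁ = jump b∈D a∈D (Adj⇒≢ (Adj-sym a~b)) (Adj-sym a~b) c∉D a~c
        m₂ : Move G E₁ E₂
        m₂ = jump (∈-afterJump r∈D r≢b r≢a) (∈-afterJump q∈D q≢b (Adj⇒≢ q~a))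
                  (Adj⇒≢ r~q) r~q (jumped∉afterJump (Adj⇒≢ a~c)) q~a
        m₃ : Move G E₂ (afterJump E₂ a c t)
        m₃ = jump target∈afterJump
                  (∈-afterJump target∈afterJump (λ { refl → c∉D r∈D }) (λ { refl → c∉D q∈D }))
                  (Adj⇒≢ a~c) a~c
                  (∉-afterJump (∉-afterJump t∉D (Adj⇒≢ (Adj-sym c~t))) (λ { refl → t∉D a∈D }))
                  c~t

    reachable-empty-near-a : ∀ {t} → t ∉ D → DistLe G t a 2 → Reachable G D t
    reachable-empty-near-a t∉D (_ , _ , here) = ⊥-elim (t∉D a∈D)
    reachable-empty-near-a t∉D (_ , _ , step t~a here) =
      Move⇒Reachable (jump b∈D a∈D (Adj⇒≢ (Adj-sym a~b)) (Adj-sym a~b) t∉D (Adj-sym t~a))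
                     target∈afterJump
    reachable-empty-near-a t∉D (_ , _ , step {v = c} t~c (step c~a here)) with c ∈? D
    ... | yes c∈D = Move⇒Reachable (jump a∈D c∈D (Adj⇒≢ (Adj-sym c~a)) (Adj-sym c~a) t∉D (Adj-sym t~c))
                                   target∈afterJump
    ... | no  c∉D = reachable-through-empty (Adj-sym c~a) (Adj-sym t~c) c∉D t∉D
    reachable-empty-near-a t∉D (_ , s≤s (s≤s ()) , step _ (step _ (step _ _)))

    reachable-near-a : ∀ {t} → DistLe G t a 2 → Reachable G D t
    reachable-near-a {t} t-a with t ∈? D
    ... | yes t∈D = D , done , t∈D
    ... | no  t∉D = reachable-empty-near-a t∉D t-a

  Path₄⇒PeggingNumberLe4 : ∀ {r q a b} → (∀ x u v → Adj G u v → VEDistLe G x u v 2) →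
                           Path₄ r q a b → PeggingNumberLe G 4
  Path₄⇒PeggingNumberLe4 {r} {q} {a} {b} within2 P =
    ∣ D ∣ , 1≤∣fourSet∣ r q a b , ∣fourSet∣≤4 r q a b , D , refl , reachable
    where
      D = fourSet r q a b
      r∈D : r ∈ D
      r∈D = p⊆p∪q _ (x∈⁅x⁆ r)
      q∈D : q ∈ D
      q∈D = q⊆p∪q _ _ (p⊆p∪q _ (x∈⁅x⁆ q))
      a∈D : a ∈ D
      a∈D = q⊆p∪q _ _ (q⊆p∪q _ _ (p⊆p∪q _ (x∈⁅x⁆ a)))
      b∈D : b ∈ D
      b∈D = q⊆p∪q _ _ (q⊆p∪q _ _ (q⊆p∪q _ _ (x∈⁅x⁆ b)))
      reachable : ∀ t → Reachable G D t
      reachable t with within2 t q a (Path₄.q~a P)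
      ... | inj₁ t-q = reachable-near-a (Path₄-reverse P) b∈D a∈D q∈D r∈D t-q
      ... | inj₂ t-a = reachable-near-a P r∈D q∈D a∈D b∈D t-a

proposition6p1 : (n : ℕ) (G : Graph n) → VEDiameterTwo G → PeggingNumberLe G 4
proposition6p1 _ G (_ , within2 , x , u , v , u~v , far) with within2 x u v u~v
... | inj₁ x-u = Path₄⇒PeggingNumberLe4 G within2 (proj₂ (far-from-edge⇒Path₄ G u~v far x-u))
... | inj₂ x-v = Path₄⇒PeggingNumberLe4 G within2
                   (proj₂ (far-from-edge⇒Path₄ G (Adj-sym G u~v) (far ∘ swap) x-v))
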